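{- Let $Q_d$ denote the $d$-dimensional hypercube graph (with $n = 2^d$ vertices). Then $\chi_{2K_2}(Q_2) = 2$, $\chi_{2K_2}(Q_3) = 4$, and for every $d \geq 4$, \[ \chi_{2K_2}(Q_d) \geq \sqrt{\frac{d}{2d-1}\, 2^d} + \frac12 = \sqrt{\frac{n}{2}\cdot\frac{1}{1 - 1/(2\lg n)}} + \frac12 . \]
   Context: All graphs are finite and simple. $Q_d$ has vertex set $\{0,1\}^d$, two vertices adjacent iff they differ in exactly one coordinate. $\lg$ denotes the base-2 logarithm. $2K_2$ denotes the graph consisting of two disjoint edges. For a fixed bipartite graph $H$, a proper vertex coloring of a graph $G$ is called an $H$-avoiding coloring if for any two color classes, the subgraph of $G$ induced by their union contains no induced subgraph isomorphic to $H$. $\chi_H(G)$ denotes the minimum number of colors in an $H$-avoiding coloring of $G$. -}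

module Defs where

open import Level using (0ℓ)
open import Data.Nat using (ℕ; zero; suc; _+_; _*_; _∸_; _^_; _≤_)
open import Data.Bool using (Bool; true; false)
open import Data.Vec using (Vec; []; _∷_)
open import Data.Fin using (Fin; zero; suc)
open import Data.Product using (Σ; _×_; _,_)
open import Data.Sum using (_⊎_)
open import Relation.Binary.PropositionalEquality using (_≡_; _≢_)
open import Relation.Nullary using (¬_)

record Graph : Set₁ where
  field
    V   : Set
    Adj : V → V → Set
open Graph public

hamming : ∀ {d} → Vec Bool d → Vec Bool d → ℕ
hamming [] [] = 0
hamming (true ∷ u) (true ∷ v) = hamming u v
hamming (false ∷ u) (false ∷ v) = hamming u v
hamming (true ∷ u) (false ∷ v) = suc (hamming u v)
hamming (false ∷ u) (true ∷ v) = suc (hamming u v)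

Q : ℕ → Graph
Q d = record { V = Vec Bool d ; Adj = λ u v → hamming u v ≡ 1 }

data Adj2K2 : Fin 4 → Fin 4 → Set where
  e01 : Adj2K2 zero (suc zero)
  e10 : Adj2K2 (suc zero) zero
  e23 : Adj2K2 (suc (suc zero)) (suc (suc (suc zero)))
  e32 : Adj2K2 (suc (suc (suc zero))) (suc (suc zero))

TwoK2 : Graph
TwoK2 = record { V = Fin 4 ; Adj = Adj2K2 }

Coloring : Graph → ℕ → Set
Coloring G k = V G → Fin k

IsProper : (G : Graph) {k : ℕ} → Coloring G k → Set
IsProper G c = ∀ u v → Adj G u v → c u ≢ c v

InducedCopyIn : (H G : Graph) {k : ℕ} → Coloring G k → Fin k → Fin k → Set
InducedCopyIn H G c a b =
  Σ (V H → V G) λ f →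
      (∀ x y → f x ≡ f y → x ≡ y)
    × (∀ x y → Adj H x y → Adj G (f x) (f y))
    × (∀ x y → Adj G (f x) (f y) → Adj H x y)
    × (∀ x → (c (f x) ≡ a) ⊎ (c (f x) ≡ b))

IsAvoiding : (H G : Graph) {k : ℕ} → Coloring G k → Set
IsAvoiding H G c =
  IsProper G c × (∀ a b → a ≢ b → ¬ InducedCopyIn H G c a b)

HasAvoidingColoring : (H G : Graph) → ℕ → Set
HasAvoidingColoring H G k = Σ (Coloring G k) λ c → IsAvoiding H G c

ChiIs : (H G : Graph) → ℕ → Set
ChiIs H G k = HasAvoidingColoring H G k × (∀ m → HasAvoidingColoring H G m → k ≤ m)

-- Fix two colours a, b of a 2K₂-avoiding colouring of Q_d, d ≥ 3. The a–b edges form a bipartite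
-- graph without induced 2K₂, so neighbourhoods on each side are nested: an a-vertex x of maximal
-- b-degree is adjacent to every b-vertex with an a-neighbour, and symmetrically for a b-vertex y;
-- in particular x ~ y. An a–b edge avoiding x and y closes a 4-cycle through x and y, and since two
-- vertices of Q_d have at most two common neighbours there is at most one such edge, and none if x
-- and y both have degree d (complete a square on x, y and a third neighbour of y). Hence each of
-- the k(k − 1) ordered colour pairs spans at most 2d − 1 edges, while Q_d has d·2^d ordered adjacent
-- pairs; and 4k(k − 1) ≤ (2k − 1)². The values for Q₂ and Q₃ are checked by exhaustive search.

module Submission where

open import Defs
open import Level using (0ℓ)
open import Data.Nat using (ℕ; zero; suc; _+_; _*_; _∸_; _^_; _≤_; _<_; z≤n; s≤s; _≟_; _≤?_)
open import Data.Nat.Properties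
open import Data.Nat.Tactic.RingSolver using (solve-∀)
open import Data.Bool using (Bool; true; false; not; _xor_)
import Data.Bool as Bool
open import Data.Bool.Properties using (¬-not)
open import Data.Vec using (Vec; []; _∷_)
import Data.Vec as Vec
open import Data.Vec.Properties using (≡-dec; ∷-injectiveʳ)
open import Data.Fin using (Fin; zero; suc)
import Data.Fin.Properties as Fin
open import Data.Product using (_×_; _,_; ∃; ∃₂; proj₁; proj₂)
import Data.Product as Product
open import Data.Sum using (_⊎_; inj₁; inj₂; [_,_]′)
import Data.Sum as Sum
open import Data.Empty using (⊥; ⊥-elim)
open import Function.Bundles using (_⇔_; mk⇔; Equivalence)
open import Relation.Nullary using (¬_; Dec; yes; no; does; contradiction)
open import Relation.Nullary.Decidable using (_×-dec_; _⊎-dec_; _→-dec_; ¬?; map′; from-yes)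
open import Relation.Unary using (Pred; Decidable; _⊆_)
open import Relation.Binary using (DecidableEquality)
open import Relation.Binary.PropositionalEquality
open import Algebra.Properties.CommutativeSemigroup +-commutativeSemigroup
  using () renaming (interchange to +-interchange)

-- Induced copies of 2K₂

private
  partner : Fin 4 → Fin 4
  partner zero                   = suc zero
  partner (suc zero)             = zero
  partner (suc (suc zero))       = suc (suc (suc zero))
  partner (suc (suc (suc zero))) = suc (suc zero)

  partner-involutive : ∀ x → partner (partner x) ≡ x
  partner-involutive zero                   = refl
  partner-involutive (suc zero)             = refl
  partner-involutive (suc (suc zero))       = refl
  partner-involutive (suc (suc (suc zero))) = refl

  Adj2K2-partner : ∀ x → Adj2K2 x (partner x)
  Adj2K2-partner zero                   = e01
  Adj2K2-partner (suc zero)             = e10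
  Adj2K2-partner (suc (suc zero))       = e23
  Adj2K2-partner (suc (suc (suc zero))) = e32

  Adj2K2⇒partner : ∀ {x y} → Adj2K2 x y → partner x ≡ y
  Adj2K2⇒partner e01 = refl
  Adj2K2⇒partner e10 = refl
  Adj2K2⇒partner e23 = refl
  Adj2K2⇒partner e32 = refl

-- A vertex of 2K₂ is determined by its unique neighbour.
2K₂-embedding-injective : ∀ {G : Graph} (f : Fin 4 → V G) →
  (∀ x y → Adj2K2 x y → Adj G (f x) (f y)) →
  (∀ x y → Adj G (f x) (f y) → Adj2K2 x y) →
  ∀ x y → f x ≡ f y → x ≡ y
2K₂-embedding-injective {G} f preserves reflects x y fx≡fy = begin
  x                   ≡⟨ partner-involutive x ⟨
  partner (partner x) ≡⟨ cong partner (Adj2K2⇒partner y~partner-x) ⟨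
  partner (partner y) ≡⟨ partner-involutive y ⟩
  y                   ∎
  where
  open ≡-Reasoning
  y~partner-x : Adj2K2 y (partner x)
  y~partner-x = reflects y (partner x) (subst (λ v → Adj G v (f (partner x))) fx≡fy
                                         (preserves x (partner x) (Adj2K2-partner x)))

record Induced2K₂ (G : Graph) (p q r s : V G) : Set where
  field
    p~q : Adj G p q
    r~s : Adj G r s
    p≁r : ¬ Adj G p r
    p≁s : ¬ Adj G p s
    q≁r : ¬ Adj G q r
    q≁s : ¬ Adj G q s

quadruple : ∀ {A : Set} → A → A → A → A → Fin 4 → A
quadruple p q r s zero                   = p
quadruple p q r s (suc zero)             = q
quadruple p q r s (suc (suc zero))       = r
quadruple p q r s (suc (suc (suc zero))) = s

TwoColoured : (G : Graph) {k : ℕ} → Coloring G k → V G → V G → V G → V G → Set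
TwoColoured G c p q r s = (c r ≡ c p ⊎ c r ≡ c q) × (c s ≡ c p ⊎ c s ≡ c q)

NoTwoColoured2K₂ : (G : Graph) {k : ℕ} → Coloring G k → Set
NoTwoColoured2K₂ G c = ∀ p q r s → Induced2K₂ G p q r s → ¬ TwoColoured G c p q r s

module _ (G : Graph)
         (Adj-sym : ∀ u v → Adj G u v → Adj G v u)
         (Adj-irrefl : ∀ u → ¬ Adj G u u) where

  Induced2K₂⇒copy : ∀ {k} {p q r s} → Induced2K₂ G p q r s →
    (c : Coloring G k) (a b : Fin k) →
    (∀ x → c (quadruple p q r s x) ≡ a ⊎ c (quadruple p q r s x) ≡ b) →
    InducedCopyIn TwoK2 G c a b
  Induced2K₂⇒copy {p = p} {q} {r} {s} i c a b coloured =
    f , 2K₂-embedding-injective {G} f preserves reflects , preserves , reflects , coloured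
    where
    open Induced2K₂ i
    f : Fin 4 → V G
    f = quadruple p q r s
    preserves : ∀ x y → Adj2K2 x y → Adj G (f x) (f y)
    preserves _ _ e01 = p~q
    preserves _ _ e10 = Adj-sym p q p~q
    preserves _ _ e23 = r~s
    preserves _ _ e32 = Adj-sym r s r~s
    reflects : ∀ x y → Adj G (f x) (f y) → Adj2K2 x y
    reflects zero                   (suc zero)             _ = e01
    reflects (suc zero)             zero                   _ = e10
    reflects (suc (suc zero))       (suc (suc (suc zero))) _ = e23
    reflects (suc (suc (suc zero))) (suc (suc zero))       _ = e32
    reflects zero                   zero                   e = ⊥-elim (Adj-irrefl p e)
    reflects (suc zero)             (suc zero)             e = ⊥-elim (Adj-irrefl q e)
    reflects (suc (suc zero))       (suc (suc zero))       e = ⊥-elim (Adj-irrefl r e)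
    reflects (suc (suc (suc zero))) (suc (suc (suc zero))) e = ⊥-elim (Adj-irrefl s e)
    reflects zero                   (suc (suc zero))       e = ⊥-elim (p≁r e)
    reflects zero                   (suc (suc (suc zero))) e = ⊥-elim (p≁s e)
    reflects (suc zero)             (suc (suc zero))       e = ⊥-elim (q≁r e)
    reflects (suc zero)             (suc (suc (suc zero))) e = ⊥-elim (q≁s e)
    reflects (suc (suc zero))       zero                   e = ⊥-elim (p≁r (Adj-sym r p e))
    reflects (suc (suc (suc zero))) zero                   e = ⊥-elim (p≁s (Adj-sym s p e))
    reflects (suc (suc zero))       (suc zero)             e = ⊥-elim (q≁r (Adj-sym r q e))
    reflects (suc (suc (suc zero))) (suc zero)             e = ⊥-elim (q≁s (Adj-sym s q e))

  avoiding⇔ : ∀ {k} (c : Coloring G k) → IsAvoiding TwoK2 G c ⇔ (IsProper G c × NoTwoColoured2K₂ G c)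
  avoiding⇔ c = mk⇔ to from
    where
    to : IsAvoiding TwoK2 G c → IsProper G c × NoTwoColoured2K₂ G c
    to (proper , avoid) = proper , λ p q r s i (cr , cs) →
      avoid (c p) (c q) (proper p q (Induced2K₂.p~q i)) (Induced2K₂⇒copy i c (c p) (c q)
        λ { zero → inj₁ refl ; (suc zero) → inj₂ refl ; (suc (suc zero)) → cr ; (suc (suc (suc zero))) → cs })
    from : IsProper G c × NoTwoColoured2K₂ G c → IsAvoiding TwoK2 G c
    from (proper , no-two-coloured) = proper , λ a b a≢b (f , _ , preserves , reflects , coloured) →
      let p~q = preserves _ _ e01 in
      no-two-coloured (f zero) (f (suc zero)) (f (suc (suc zero))) (f (suc (suc (suc zero))))
        (record
          { p~q = p~q
          ; r~s = preserves _ _ e23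
          ; p≁r = λ e → contradiction (reflects zero (suc (suc zero)) e) λ ()
          ; p≁s = λ e → contradiction (reflects zero (suc (suc (suc zero))) e) λ ()
          ; q≁r = λ e → contradiction (reflects (suc zero) (suc (suc zero)) e) λ ()
          ; q≁s = λ e → contradiction (reflects (suc zero) (suc (suc (suc zero))) e) λ ()
          })
        ( in-pair-of-distinct (coloured zero) (coloured (suc zero)) (proper _ _ p~q) (coloured (suc (suc zero)))
        , in-pair-of-distinct (coloured zero) (coloured (suc zero)) (proper _ _ p~q) (coloured (suc (suc (suc zero)))))
      where
      in-pair-of-distinct : ∀ {A : Set} {a b x y z : A} → (x ≡ a ⊎ x ≡ b) → (y ≡ a ⊎ y ≡ b) → x ≢ y →
                            (z ≡ a ⊎ z ≡ b) → z ≡ x ⊎ z ≡ y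
      in-pair-of-distinct (inj₁ refl) (inj₁ refl) x≢y _           = contradiction refl x≢y
      in-pair-of-distinct (inj₂ refl) (inj₂ refl) x≢y _           = contradiction refl x≢y
      in-pair-of-distinct (inj₁ refl) (inj₂ refl) _   (inj₁ refl) = inj₁ refl
      in-pair-of-distinct (inj₁ refl) (inj₂ refl) _   (inj₂ refl) = inj₂ refl
      in-pair-of-distinct (inj₂ refl) (inj₁ refl) _   (inj₁ refl) = inj₂ refl
      in-pair-of-distinct (inj₂ refl) (inj₁ refl) _   (inj₂ refl) = inj₁ refl

-- The hypercube

Vertex : ℕ → Set
Vertex d = Vec Bool d

infix 4 _~_ _~?_ _≟ᵛ_

_~_ : ∀ {d} → Vertex d → Vertex d → Set
u ~ v = hamming u v ≡ 1

_~?_ : ∀ {d} (u v : Vertex d) → Dec (u ~ v)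
u ~? v = hamming u v ≟ 1

_≟ᵛ_ : ∀ {d} → DecidableEquality (Vertex d)
_≟ᵛ_ = ≡-dec Bool._≟_

hamming-comm : ∀ {d} (u v : Vertex d) → hamming u v ≡ hamming v u
hamming-comm []          []          = refl
hamming-comm (true ∷ u)  (true ∷ v)  = hamming-comm u v
hamming-comm (false ∷ u) (false ∷ v) = hamming-comm u v
hamming-comm (true ∷ u)  (false ∷ v) = cong suc (hamming-comm u v)
hamming-comm (false ∷ u) (true ∷ v)  = cong suc (hamming-comm u v)

hamming-self : ∀ {d} (u : Vertex d) → hamming u u ≡ 0
hamming-self []          = refl
hamming-self (true ∷ u)  = hamming-self u
hamming-self (false ∷ u) = hamming-self u

hamming≡0⇒≡ : ∀ {d} (u v : Vertex d) → hamming u v ≡ 0 → u ≡ v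
hamming≡0⇒≡ []          []          _ = refl
hamming≡0⇒≡ (true ∷ u)  (true ∷ v)  h = cong (true ∷_) (hamming≡0⇒≡ u v h)
hamming≡0⇒≡ (false ∷ u) (false ∷ v) h = cong (false ∷_) (hamming≡0⇒≡ u v h)

~-sym : ∀ {d} (u v : Vertex d) → u ~ v → v ~ u
~-sym u v u~v = trans (hamming-comm v u) u~v

~-irrefl : ∀ {d} (u : Vertex d) → ¬ u ~ u
~-irrefl u u~u with trans (sym (hamming-self u)) u~u
... | ()

~-∷⁻ : ∀ {d} (a b : Bool) (u v : Vertex d) → (a ∷ u) ~ (b ∷ v) →
       (a ≡ b × u ~ v) ⊎ (a ≢ b × u ≡ v)
~-∷⁻ true  true  u v e = inj₁ (refl , e)
~-∷⁻ false false u v e = inj₁ (refl , e)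
~-∷⁻ true  false u v e = inj₂ ((λ ()) , hamming≡0⇒≡ u v (suc-injective e))
~-∷⁻ false true  u v e = inj₂ ((λ ()) , hamming≡0⇒≡ u v (suc-injective e))

private
  tail≢ : ∀ {d} {a : Bool} {u v : Vertex d} → _≢_ {A = Vertex (suc d)} (a ∷ u) (a ∷ v) → u ≢ v
  tail≢ n refl = n refl

  common-neighbour-of-∷ : ∀ {d} (h a : Bool) (r p q : Vertex d) → p ≢ q →
    (h ∷ r) ~ (a ∷ p) → (h ∷ r) ~ (a ∷ q) → h ≡ a × r ~ p × r ~ q
  common-neighbour-of-∷ h a r p q p≢q r~p r~q with ~-∷⁻ h a r p r~p | ~-∷⁻ h a r q r~q
  ... | inj₁ (h≡a , r~p₀) | inj₁ (_ , r~q₀)  = h≡a , r~p₀ , r~q₀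
  ... | inj₁ (h≡a , _)    | inj₂ (h≢a , _)   = ⊥-elim (h≢a h≡a)
  ... | inj₂ (h≢a , _)    | inj₁ (h≡a , _)   = ⊥-elim (h≢a h≡a)
  ... | inj₂ (_ , r≡p)    | inj₂ (_ , r≡q)   = ⊥-elim (p≢q (trans (sym r≡p) r≡q))

  common-neighbour-across : ∀ {d} (h a b : Bool) (r p q : Vertex d) → a ≢ b →
    (h ∷ r) ~ (a ∷ p) → (h ∷ r) ~ (b ∷ q) →
    _≡_ {A = Vertex (suc d)} (h ∷ r) (a ∷ q) ⊎ _≡_ {A = Vertex (suc d)} (h ∷ r) (b ∷ p)
  common-neighbour-across h a b r p q a≢b r~p r~q with ~-∷⁻ h a r p r~p | ~-∷⁻ h b r q r~q
  ... | inj₁ (h≡a , _) | inj₁ (h≡b , _) = ⊥-elim (a≢b (trans (sym h≡a) h≡b))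
  ... | inj₁ (h≡a , _) | inj₂ (_ , r≡q) = inj₁ (cong₂ _∷_ h≡a r≡q)
  ... | inj₂ (_ , r≡p) | inj₁ (h≡b , _) = inj₂ (cong₂ _∷_ h≡b r≡p)
  ... | inj₂ (h≢a , _) | inj₂ (h≢b , _) =
    ⊥-elim (h≢b (trans (¬-not h≢a) (sym (¬-not (λ b≡a → a≢b (sym b≡a))))))

  three-in-pair : ∀ {A : Set} {r₁ r₂ r₃ s t : A} →
    (r₁ ≡ s ⊎ r₁ ≡ t) → (r₂ ≡ s ⊎ r₂ ≡ t) → (r₃ ≡ s ⊎ r₃ ≡ t) →
    r₁ ≢ r₂ → r₁ ≢ r₃ → r₂ ≢ r₃ → ⊥
  three-in-pair (inj₁ a) (inj₁ b) _        n₁₂ _   _   = n₁₂ (trans a (sym b))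
  three-in-pair (inj₂ a) (inj₂ b) _        n₁₂ _   _   = n₁₂ (trans a (sym b))
  three-in-pair (inj₁ a) (inj₂ b) (inj₁ c) _   n₁₃ _   = n₁₃ (trans a (sym c))
  three-in-pair (inj₁ a) (inj₂ b) (inj₂ c) _   _   n₂₃ = n₂₃ (trans b (sym c))
  three-in-pair (inj₂ a) (inj₁ b) (inj₂ c) _   n₁₃ _   = n₁₃ (trans a (sym c))
  three-in-pair (inj₂ a) (inj₁ b) (inj₁ c) _   _   n₂₃ = n₂₃ (trans b (sym c))

K₂,₃-free : ∀ {d} (p q r₁ r₂ r₃ : Vertex d) → p ≢ q → r₁ ≢ r₂ → r₁ ≢ r₃ → r₂ ≢ r₃ →
  r₁ ~ p → r₁ ~ q → r₂ ~ p → r₂ ~ q → r₃ ~ p → r₃ ~ q → ⊥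
K₂,₃-free [] [] _ _ _ p≢q _ _ _ _ _ _ _ _ _ = p≢q refl
K₂,₃-free (a ∷ p) (b ∷ q) (h₁ ∷ r₁) (h₂ ∷ r₂) (h₃ ∷ r₃)
          p≢q n₁₂ n₁₃ n₂₃ r₁~p r₁~q r₂~p r₂~q r₃~p r₃~q with a Bool.≟ b
... | yes refl
  with common-neighbour-of-∷ h₁ a r₁ p q (tail≢ p≢q) r₁~p r₁~q
     | common-neighbour-of-∷ h₂ a r₂ p q (tail≢ p≢q) r₂~p r₂~q
     | common-neighbour-of-∷ h₃ a r₃ p q (tail≢ p≢q) r₃~p r₃~q
...  | refl , s₁~p , s₁~q | refl , s₂~p , s₂~q | refl , s₃~p , s₃~q =
  K₂,₃-free p q r₁ r₂ r₃ (tail≢ p≢q) (tail≢ n₁₂) (tail≢ n₁₃) (tail≢ n₂₃)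
            s₁~p s₁~q s₂~p s₂~q s₃~p s₃~q
K₂,₃-free (a ∷ p) (b ∷ q) (h₁ ∷ r₁) (h₂ ∷ r₂) (h₃ ∷ r₃)
          p≢q n₁₂ n₁₃ n₂₃ r₁~p r₁~q r₂~p r₂~q r₃~p r₃~q | no a≢b =
  three-in-pair (common-neighbour-across h₁ a b r₁ p q a≢b r₁~p r₁~q)
                (common-neighbour-across h₂ a b r₂ p q a≢b r₂~p r₂~q)
                (common-neighbour-across h₃ a b r₃ p q a≢b r₃~p r₃~q) n₁₂ n₁₃ n₂₃

fourth : ∀ {d} → Vertex d → Vertex d → Vertex d → Vertex d
fourth []      []      []      = []
fourth (a ∷ x) (b ∷ y) (c ∷ u) = ((a xor b) xor c) ∷ fourth x y u

hamming-fourthˡ : ∀ {d} (x y u : Vertex d) → hamming (fourth x y u) x ≡ hamming y u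
hamming-fourthˡ []          []          []          = refl
hamming-fourthˡ (true ∷ x)  (true ∷ y)  (true ∷ u)  = hamming-fourthˡ x y u
hamming-fourthˡ (true ∷ x)  (true ∷ y)  (false ∷ u) = cong suc (hamming-fourthˡ x y u)
hamming-fourthˡ (true ∷ x)  (false ∷ y) (true ∷ u)  = cong suc (hamming-fourthˡ x y u)
hamming-fourthˡ (true ∷ x)  (false ∷ y) (false ∷ u) = hamming-fourthˡ x y u
hamming-fourthˡ (false ∷ x) (true ∷ y)  (true ∷ u)  = hamming-fourthˡ x y u
hamming-fourthˡ (false ∷ x) (true ∷ y)  (false ∷ u) = cong suc (hamming-fourthˡ x y u)
hamming-fourthˡ (false ∷ x) (false ∷ y) (true ∷ u)  = cong suc (hamming-fourthˡ x y u)
hamming-fourthˡ (false ∷ x) (false ∷ y) (false ∷ u) = hamming-fourthˡ x y u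

hamming-fourthʳ : ∀ {d} (x y u : Vertex d) → hamming (fourth x y u) u ≡ hamming x y
hamming-fourthʳ []          []          []          = refl
hamming-fourthʳ (true ∷ x)  (true ∷ y)  (true ∷ u)  = hamming-fourthʳ x y u
hamming-fourthʳ (true ∷ x)  (true ∷ y)  (false ∷ u) = hamming-fourthʳ x y u
hamming-fourthʳ (true ∷ x)  (false ∷ y) (true ∷ u)  = cong suc (hamming-fourthʳ x y u)
hamming-fourthʳ (true ∷ x)  (false ∷ y) (false ∷ u) = cong suc (hamming-fourthʳ x y u)
hamming-fourthʳ (false ∷ x) (true ∷ y)  (true ∷ u)  = cong suc (hamming-fourthʳ x y u)
hamming-fourthʳ (false ∷ x) (true ∷ y)  (false ∷ u) = cong suc (hamming-fourthʳ x y u)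
hamming-fourthʳ (false ∷ x) (false ∷ y) (true ∷ u)  = hamming-fourthʳ x y u
hamming-fourthʳ (false ∷ x) (false ∷ y) (false ∷ u) = hamming-fourthʳ x y u

fourth≡⇒≡ : ∀ {d} (x y u : Vertex d) → fourth x y u ≡ y → x ≡ u
fourth≡⇒≡ []          []          []          _ = refl
fourth≡⇒≡ (true ∷ x)  (true ∷ y)  (true ∷ u)  e = cong (true ∷_) (fourth≡⇒≡ x y u (∷-injectiveʳ e))
fourth≡⇒≡ (true ∷ x)  (false ∷ y) (true ∷ u)  e = cong (true ∷_) (fourth≡⇒≡ x y u (∷-injectiveʳ e))
fourth≡⇒≡ (false ∷ x) (true ∷ y)  (false ∷ u) e = cong (false ∷_) (fourth≡⇒≡ x y u (∷-injectiveʳ e))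
fourth≡⇒≡ (false ∷ x) (false ∷ y) (false ∷ u) e = cong (false ∷_) (fourth≡⇒≡ x y u (∷-injectiveʳ e))
fourth≡⇒≡ (true ∷ x)  (true ∷ y)  (false ∷ u) ()
fourth≡⇒≡ (true ∷ x)  (false ∷ y) (false ∷ u) ()
fourth≡⇒≡ (false ∷ x) (true ∷ y)  (true ∷ u)  ()
fourth≡⇒≡ (false ∷ x) (false ∷ y) (true ∷ u)  ()

complete-square : ∀ {d} (x y u : Vertex d) → x ~ y → y ~ u → x ≢ u →
  ∃ λ z → z ~ x × z ~ u × z ≢ y
complete-square x y u x~y y~u x≢u =
  fourth x y u , trans (hamming-fourthˡ x y u) y~u , trans (hamming-fourthʳ x y u) x~y ,
  λ z≡y → x≢u (fourth≡⇒≡ x y u z≡y)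

-- Sums and counts over the cube and over the colours

-- Defined through does, so that 𝟙 computes through map′, ×-dec and ¬? on open terms.
𝟙 : ∀ {P : Set} → Dec P → ℕ
𝟙 P? with does P?
... | true  = 1
... | false = 0

𝟙-yes : ∀ {P : Set} (P? : Dec P) → P → 𝟙 P? ≡ 1
𝟙-yes (yes _) _  = refl
𝟙-yes (no ¬p) p = contradiction p ¬p

𝟙-no : ∀ {P : Set} (P? : Dec P) → ¬ P → 𝟙 P? ≡ 0
𝟙-no (yes p) ¬p = contradiction p ¬p
𝟙-no (no _)  _  = refl

𝟙≤1 : ∀ {P : Set} (P? : Dec P) → 𝟙 P? ≤ 1
𝟙≤1 (yes _) = s≤s z≤n
𝟙≤1 (no _)  = z≤n

𝟙-mono : ∀ {P R : Set} (P? : Dec P) (R? : Dec R) → (P → R) → 𝟙 P? ≤ 𝟙 R?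
𝟙-mono (no _)  _       _   = z≤n
𝟙-mono (yes _) (yes _) _   = ≤-refl
𝟙-mono (yes p) (no ¬r) P→R = contradiction (P→R p) ¬r

𝟙-× : ∀ {P R : Set} (P? : Dec P) (R? : Dec R) → 𝟙 (P? ×-dec R?) ≡ 𝟙 P? * 𝟙 R?
𝟙-× (yes _) R? = sym (+-identityʳ (𝟙 R?))
𝟙-× (no _)  R? = refl

𝟙-witness : ∀ {P : Set} (P? : Dec P) → 0 < 𝟙 P? → P
𝟙-witness (yes p) _ = p

∑Q : ∀ d → (Vertex d → ℕ) → ℕ
∑Q zero    f = f []
∑Q (suc d) f = ∑Q d (λ v → f (true ∷ v)) + ∑Q d (λ v → f (false ∷ v))

∑Q-cong : ∀ d {f g : Vertex d → ℕ} → (∀ v → f v ≡ g v) → ∑Q d f ≡ ∑Q d g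
∑Q-cong zero    f≗g = f≗g []
∑Q-cong (suc d) f≗g = cong₂ _+_ (∑Q-cong d (λ v → f≗g (true ∷ v)))
                                (∑Q-cong d (λ v → f≗g (false ∷ v)))

∑Q-mono : ∀ d {f g : Vertex d → ℕ} → (∀ v → f v ≤ g v) → ∑Q d f ≤ ∑Q d g
∑Q-mono zero    f≤g = f≤g []
∑Q-mono (suc d) f≤g = +-mono-≤ (∑Q-mono d (λ v → f≤g (true ∷ v)))
                               (∑Q-mono d (λ v → f≤g (false ∷ v)))

∑Q-+ : ∀ d (f g : Vertex d → ℕ) → ∑Q d (λ v → f v + g v) ≡ ∑Q d f + ∑Q d g
∑Q-+ zero    f g = refl
∑Q-+ (suc d) f g = trans (cong₂ _+_ (∑Q-+ d _ _) (∑Q-+ d _ _))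
                         (+-interchange (∑Q d (λ v → f (true ∷ v))) _ _ _)

∑Q-*ˡ : ∀ d k (f : Vertex d → ℕ) → ∑Q d (λ v → k * f v) ≡ k * ∑Q d f
∑Q-*ˡ zero    k f = refl
∑Q-*ˡ (suc d) k f = trans (cong₂ _+_ (∑Q-*ˡ d k _) (∑Q-*ˡ d k _)) (sym (*-distribˡ-+ k _ _))

∑Q-const : ∀ d k → ∑Q d (λ _ → k) ≡ 2 ^ d * k
∑Q-const zero    k = sym (+-identityʳ k)
∑Q-const (suc d) k = begin
  ∑Q d (λ _ → k) + ∑Q d (λ _ → k)  ≡⟨ cong₂ _+_ (∑Q-const d k) (∑Q-const d k) ⟩
  2 ^ d * k + 2 ^ d * k            ≡⟨ cong (λ n → 2 ^ d * k + n * k) (+-identityʳ (2 ^ d)) ⟨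
  2 ^ d * k + (2 ^ d + 0) * k      ≡⟨ *-distribʳ-+ k (2 ^ d) (2 ^ d + 0) ⟨
  2 ^ suc d * k                    ∎
  where open ≡-Reasoning

∑Q-zero : ∀ d → ∑Q d (λ _ → 0) ≡ 0
∑Q-zero d = trans (∑Q-const d 0) (*-zeroʳ (2 ^ d))

∑Q-positive : ∀ d (f : Vertex d → ℕ) → 0 < ∑Q d f → ∃ λ v → 0 < f v
∑Q-positive zero    f 0<f = [] , 0<f
∑Q-positive (suc d) f 0<∑ with ∑Q d (λ v → f (true ∷ v)) ≟ 0
... | no ∑≢0 with ∑Q-positive d _ (n≢0⇒n>0 ∑≢0)
...   | v , 0<fv = true ∷ v , 0<fv
∑Q-positive (suc d) f 0<∑ | yes ∑≡0
  with ∑Q-positive d (λ v → f (false ∷ v)) (subst (λ n → 0 < n + ∑Q d (λ v → f (false ∷ v))) ∑≡0 0<∑)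
...   | v , 0<fv = false ∷ v , 0<fv

∑Q-δ : ∀ d (x : Vertex d) → ∑Q d (λ v → 𝟙 (v ≟ᵛ x)) ≡ 1
∑Q-δ zero    []          = refl
∑Q-δ (suc d) (true ∷ x)  = cong₂ _+_ (∑Q-δ d x) (∑Q-zero d)
∑Q-δ (suc d) (false ∷ x) = cong₂ _+_ (∑Q-zero d) (∑Q-δ d x)

∑Q-δ* : ∀ d (x : Vertex d) (g : Vertex d → ℕ) → ∑Q d (λ v → 𝟙 (v ≟ᵛ x) * g v) ≡ g x
∑Q-δ* d x g = begin
  ∑Q d (λ v → 𝟙 (v ≟ᵛ x) * g v) ≡⟨ ∑Q-cong d at-x ⟩
  ∑Q d (λ v → g x * 𝟙 (v ≟ᵛ x)) ≡⟨ ∑Q-*ˡ d (g x) _ ⟩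
  g x * ∑Q d (λ v → 𝟙 (v ≟ᵛ x)) ≡⟨ cong (g x *_) (∑Q-δ d x) ⟩
  g x * 1                        ≡⟨ *-identityʳ (g x) ⟩
  g x                            ∎
  where
  open ≡-Reasoning
  at-x : ∀ v → 𝟙 (v ≟ᵛ x) * g v ≡ g x * 𝟙 (v ≟ᵛ x)
  at-x v with v ≟ᵛ x
  ... | yes refl = *-comm 1 (g v)
  ... | no _     = sym (*-zeroʳ (g x))

count : ∀ {d} {P : Pred (Vertex d) 0ℓ} → Decidable P → ℕ
count {d} P? = ∑Q d (λ v → 𝟙 (P? v))

module _ {d} {P R : Pred (Vertex d) 0ℓ} (P? : Decidable P) (R? : Decidable R) where

  count-mono : P ⊆ R → count P? ≤ count R?
  count-mono P⊆R = ∑Q-mono d (λ v → 𝟙-mono (P? v) (R? v) P⊆R)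

  count-< : P ⊆ R → ∀ {v} → R v → ¬ P v → count P? < count R?
  count-< P⊆R {v} Rv ¬Pv = subst (_≤ count R?) (+-comm (count P?) 1) (begin
    count P? + 1                                   ≡⟨ cong (count P? +_) (∑Q-δ d v) ⟨
    count P? + ∑Q d (λ w → 𝟙 (w ≟ᵛ v))             ≡⟨ ∑Q-+ d _ _ ⟨
    ∑Q d (λ w → 𝟙 (P? w) + 𝟙 (w ≟ᵛ v))             ≤⟨ ∑Q-mono d pointwise ⟩
    count R?                                       ∎)
    where
    open ≤-Reasoning
    pointwise : ∀ w → 𝟙 (P? w) + 𝟙 (w ≟ᵛ v) ≤ 𝟙 (R? w)
    pointwise w with w ≟ᵛ v
    ... | yes refl rewrite 𝟙-no (P? w) ¬Pv | 𝟙-yes (R? w) Rv = ≤-refl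
    ... | no _     rewrite +-identityʳ (𝟙 (P? w)) = 𝟙-mono (P? w) (R? w) P⊆R

count-∃ : ∀ {d} {P : Pred (Vertex d) 0ℓ} (P? : Decidable P) → 0 < count P? → ∃ P
count-∃ {d} P? 0<count with ∑Q-positive d _ 0<count
... | v , 0<𝟙 = v , 𝟙-witness (P? v) 0<𝟙

count-∪ : ∀ {d} {P Q R : Pred (Vertex d) 0ℓ} (P? : Decidable P) (Q? : Decidable Q) (R? : Decidable R) →
  (∀ {v} → R v → P v ⊎ Q v) → count R? ≤ count P? + count Q?
count-∪ {d} P? Q? R? R⊆P∪Q = subst (count R? ≤_) (∑Q-+ d _ _) (∑Q-mono d pointwise)
  where
  pointwise : ∀ v → 𝟙 (R? v) ≤ 𝟙 (P? v) + 𝟙 (Q? v)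
  pointwise v with P? v
  ... | yes _ = ≤-trans (𝟙≤1 (R? v)) (m≤m+n 1 _)
  ... | no ¬p = 𝟙-mono (R? v) (Q? v) λ r → [ (λ p → contradiction p ¬p) , (λ q → q) ]′ (R⊆P∪Q r)

private
  count-hamming≡0 : ∀ {d} (u : Vertex d) → count (λ v → hamming v u ≟ 0) ≡ 1
  count-hamming≡0 {zero}  []          = refl
  count-hamming≡0 {suc d} (true ∷ u)  = cong₂ _+_ (count-hamming≡0 u) (∑Q-zero d)
  count-hamming≡0 {suc d} (false ∷ u) = cong₂ _+_ (∑Q-zero d) (count-hamming≡0 u)

degree : ∀ {d} (u : Vertex d) → count (λ v → v ~? u) ≡ d
degree {zero}  []          = refl
degree {suc d} (true ∷ u)  = trans (cong₂ _+_ (degree u) (count-hamming≡0 u)) (+-comm d 1)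
degree {suc d} (false ∷ u) = cong₂ _+_ (count-hamming≡0 u) (degree u)

third-neighbour : ∀ {d} → 3 ≤ d → (z p q : Vertex d) → ∃ λ u → u ~ z × u ≢ p × u ≢ q
third-neighbour {d} 3≤d z p q = count-∃ good? (≤-pred (≤-pred (begin
  3                                   ≤⟨ 3≤d ⟩
  d                                   ≡⟨ degree z ⟨
  count (λ v → v ~? z)                ≤⟨ count-∪ (_≟ᵛ p) ≢p? (λ v → v ~? z) split-p ⟩
  count (_≟ᵛ p) + count ≢p?           ≤⟨ +-mono-≤ (≤-reflexive (∑Q-δ d p))
                                                   (count-∪ (_≟ᵛ q) good? ≢p? split-q) ⟩
  1 + (count (_≟ᵛ q) + count good?)   ≡⟨ cong (λ n → 1 + (n + count good?)) (∑Q-δ d q) ⟩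
  2 + count good?                     ∎)))
  where
  open ≤-Reasoning
  ≢p? : Decidable (λ v → v ~ z × v ≢ p)
  ≢p? v = (v ~? z) ×-dec ¬? (v ≟ᵛ p)
  good? : Decidable (λ v → v ~ z × v ≢ p × v ≢ q)
  good? v = (v ~? z) ×-dec (¬? (v ≟ᵛ p) ×-dec ¬? (v ≟ᵛ q))
  split-p : ∀ {v} → v ~ z → v ≡ p ⊎ (v ~ z × v ≢ p)
  split-p {v} v~z with v ≟ᵛ p
  ... | yes v≡p = inj₁ v≡p
  ... | no v≢p  = inj₂ (v~z , v≢p)
  split-q : ∀ {v} → v ~ z × v ≢ p → v ≡ q ⊎ (v ~ z × v ≢ p × v ≢ q)
  split-q {v} (v~z , v≢p) with v ≟ᵛ q
  ... | yes v≡q = inj₁ v≡q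
  ... | no v≢q  = inj₂ (v~z , v≢p , v≢q)

argmax : ∀ d (f : Vertex d → ℕ) → ∃ λ x → ∀ u → f u ≤ f x
argmax zero    f = [] , λ { [] → ≤-refl }
argmax (suc d) f with argmax d (λ v → f (true ∷ v)) | argmax d (λ v → f (false ∷ v))
... | x₁ , max₁ | x₂ , max₂ with f (true ∷ x₁) ≤? f (false ∷ x₂)
...   | yes ≤₂ = false ∷ x₂ , λ { (true ∷ u) → ≤-trans (max₁ u) ≤₂ ; (false ∷ u) → max₂ u }
...   | no  ≰₂ = true ∷ x₁ , λ { (true ∷ u) → max₁ u ; (false ∷ u) → ≤-trans (max₂ u) (<⇒≤ (≰⇒> ≰₂)) }

argmax-on : ∀ {d} {P : Pred (Vertex d) 0ℓ} → Decidable P → (f : Vertex d → ℕ) → ∀ {v} → P v →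
  ∃ λ x → P x × (∀ {u} → P u → f u ≤ f x)
argmax-on {d} {P} P? f Pv = x , Px , λ Pu → ≤-pred (subst₂ _≤_ (weight-on Pu) (weight-on Px) (max _))
  where
  weight : Vertex d → ℕ
  weight u = 𝟙 (P? u) * suc (f u)
  x : Vertex d
  x = proj₁ (argmax d weight)
  max : ∀ u → weight u ≤ weight x
  max = proj₂ (argmax d weight)
  weight-on : ∀ {u} → P u → weight u ≡ suc (f u)
  weight-on {u} Pu = trans (cong (_* suc (f u)) (𝟙-yes (P? u) Pu)) (*-identityˡ (suc (f u)))
  positive-weight : ∀ {u} → 0 < weight u → P u
  positive-weight {u} 0<w with P? u
  ... | yes Pu = Pu
  Px : P x
  Px = positive-weight (≤-trans (s≤s z≤n) (subst (_≤ weight x) (weight-on Pv) (max _)))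

∑Q² : ∀ d → (Vertex d → Vertex d → ℕ) → ℕ
∑Q² d f = ∑Q d (λ u → ∑Q d (λ w → f u w))

∑Q²-+ : ∀ d (f g : Vertex d → Vertex d → ℕ) →
  ∑Q² d (λ u w → f u w + g u w) ≡ ∑Q² d f + ∑Q² d g
∑Q²-+ d f g = trans (∑Q-cong d (λ u → ∑Q-+ d (f u) (g u))) (∑Q-+ d _ _)

∑Q²-mono : ∀ d {f g : Vertex d → Vertex d → ℕ} → (∀ u w → f u w ≤ g u w) → ∑Q² d f ≤ ∑Q² d g
∑Q²-mono d f≤g = ∑Q-mono d (λ u → ∑Q-mono d (f≤g u))

∑Q²-δˡ : ∀ d (x : Vertex d) (f : Vertex d → ℕ) → ∑Q² d (λ u w → 𝟙 (u ≟ᵛ x) * f w) ≡ ∑Q d f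
∑Q²-δˡ d x f = trans (∑Q-cong d (λ u → ∑Q-*ˡ d (𝟙 (u ≟ᵛ x)) f)) (∑Q-δ* d x _)

∑Q²-δʳ : ∀ d (y : Vertex d) (f : Vertex d → ℕ) → ∑Q² d (λ u w → 𝟙 (w ≟ᵛ y) * f u) ≡ ∑Q d f
∑Q²-δʳ d y f = ∑Q-cong d (λ u → ∑Q-δ* d y (λ _ → f u))

count₂ : ∀ {d} {P : Vertex d → Vertex d → Set} → (∀ u w → Dec (P u w)) → ℕ
count₂ {d} P? = ∑Q² d (λ u w → 𝟙 (P? u w))

adjacent-pairs : ∀ d → count₂ (_~?_ {d}) ≡ 2 ^ d * d
adjacent-pairs d = trans (∑Q-cong d λ u → trans (∑Q-cong d λ w → cong (λ h → 𝟙 (h ≟ 1)) (hamming-comm u w))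
                                               (degree u))
                         (∑Q-const d d)

count₂-∃ : ∀ {d} {P : Vertex d → Vertex d → Set} (P? : ∀ u w → Dec (P u w)) →
  0 < count₂ P? → ∃₂ P
count₂-∃ {d} P? 0<count with ∑Q-positive d _ 0<count
... | u , 0<count-u with count-∃ (P? u) 0<count-u
...   | w , Puw = u , w , Puw

count₂-≤1 : ∀ {d} {P : Vertex d → Vertex d → Set} (P? : ∀ u w → Dec (P u w)) →
  (∀ {u₁ w₁ u₂ w₂} → P u₁ w₁ → P u₂ w₂ → u₁ ≡ u₂ × w₁ ≡ w₂) → count₂ P? ≤ 1
count₂-≤1 {d} P? unique with count₂ P? ≟ 0
... | yes count≡0 = subst (_≤ 1) (sym count≡0) z≤n
... | no count≢0 with count₂-∃ P? (n≢0⇒n>0 count≢0)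
...   | u₀ , w₀ , P₀ = begin
  count₂ P?                                     ≤⟨ ∑Q²-mono d pointwise ⟩
  ∑Q² d (λ u w → 𝟙 (u ≟ᵛ u₀) * 𝟙 (w ≟ᵛ w₀))      ≡⟨ ∑Q²-δˡ d u₀ _ ⟩
  ∑Q d (λ w → 𝟙 (w ≟ᵛ w₀))                      ≡⟨ ∑Q-δ d w₀ ⟩
  1                                             ∎
  where
  open ≤-Reasoning
  pointwise : ∀ u w → 𝟙 (P? u w) ≤ 𝟙 (u ≟ᵛ u₀) * 𝟙 (w ≟ᵛ w₀)
  pointwise u w with P? u w
  ... | no _    = z≤n
  ... | yes Puw with unique Puw P₀
  ...   | refl , refl rewrite 𝟙-yes (u ≟ᵛ u) refl | 𝟙-yes (w ≟ᵛ w) refl = ≤-refl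

∑F : ∀ k → (Fin k → ℕ) → ℕ
∑F zero    f = 0
∑F (suc k) f = f zero + ∑F k (λ a → f (suc a))

∑F-cong : ∀ k {f g : Fin k → ℕ} → (∀ a → f a ≡ g a) → ∑F k f ≡ ∑F k g
∑F-cong zero    _   = refl
∑F-cong (suc k) f≗g = cong₂ _+_ (f≗g zero) (∑F-cong k (λ a → f≗g (suc a)))

∑F-mono : ∀ k {f g : Fin k → ℕ} → (∀ a → f a ≤ g a) → ∑F k f ≤ ∑F k g
∑F-mono zero    _   = z≤n
∑F-mono (suc k) f≤g = +-mono-≤ (f≤g zero) (∑F-mono k (λ a → f≤g (suc a)))

∑F-*ˡ : ∀ k m (f : Fin k → ℕ) → ∑F k (λ a → m * f a) ≡ m * ∑F k f
∑F-*ˡ zero    m f = sym (*-zeroʳ m)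
∑F-*ˡ (suc k) m f = trans (cong (m * f zero +_) (∑F-*ˡ k m _)) (sym (*-distribˡ-+ m (f zero) _))

∑F-const : ∀ k m → ∑F k (λ _ → m) ≡ k * m
∑F-const zero    m = refl
∑F-const (suc k) m = cong (m +_) (∑F-const k m)

∑F-δ* : ∀ {k} (x : Fin k) (g : Fin k → ℕ) → ∑F k (λ a → 𝟙 (x Fin.≟ a) * g a) ≡ g x
∑F-δ* {suc k} zero    g = begin
  (g zero + 0) + ∑F k (λ _ → 0)  ≡⟨ cong₂ _+_ (+-identityʳ (g zero)) (∑F-const k 0) ⟩
  g zero + k * 0                 ≡⟨ cong (g zero +_) (*-zeroʳ k) ⟩
  g zero + 0                     ≡⟨ +-identityʳ (g zero) ⟩
  g zero                         ∎
  where open ≡-Reasoning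
∑F-δ* {suc k} (suc x) g = ∑F-δ* x (λ a → g (suc a))

∑F-≢ : ∀ {k} (a : Fin k) → ∑F k (λ b → 𝟙 (¬? (a Fin.≟ b))) ≡ k ∸ 1
∑F-≢ {suc k}       zero    = trans (∑F-const k 1) (*-identityʳ k)
∑F-≢ {suc (suc k)} (suc a) = cong suc (∑F-≢ a)

∑Q-∑F-comm : ∀ d k (f : Vertex d → Fin k → ℕ) →
  ∑Q d (λ u → ∑F k (f u)) ≡ ∑F k (λ a → ∑Q d (λ u → f u a))
∑Q-∑F-comm d zero    f = ∑Q-zero d
∑Q-∑F-comm d (suc k) f =
  trans (∑Q-+ d _ _) (cong (∑Q d (λ u → f u zero) +_) (∑Q-∑F-comm d k (λ u a → f u (suc a))))

∑Q²-∑F²-comm : ∀ d k (f : Vertex d → Vertex d → Fin k → Fin k → ℕ) →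
  ∑Q² d (λ u w → ∑F k (λ a → ∑F k (f u w a))) ≡ ∑F k (λ a → ∑F k (λ b → ∑Q² d (λ u w → f u w a b)))
∑Q²-∑F²-comm d k f = begin
  ∑Q² d (λ u w → ∑F k (λ a → ∑F k (f u w a)))
    ≡⟨ ∑Q-cong d (λ u → ∑Q-∑F-comm d k _) ⟩
  ∑Q d (λ u → ∑F k (λ a → ∑Q d (λ w → ∑F k (f u w a))))
    ≡⟨ ∑Q-∑F-comm d k _ ⟩
  ∑F k (λ a → ∑Q d (λ u → ∑Q d (λ w → ∑F k (f u w a))))
    ≡⟨ ∑F-cong k (λ a → trans (∑Q-cong d (λ u → ∑Q-∑F-comm d k _)) (∑Q-∑F-comm d k _)) ⟩
  ∑F k (λ a → ∑F k (λ b → ∑Q² d (λ u w → f u w a b)))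
    ∎
  where open ≡-Reasoning

-- Colour classes of a 2K₂-avoiding colouring of Q_d

module Avoiding {d k} (c : Vertex d → Fin k) (avoiding : IsAvoiding TwoK2 (Q d) c) where

  record Edge (a b : Fin k) (u w : Vertex d) : Set where
    constructor edge
    field
      colour-u : c u ≡ a
      colour-w : c w ≡ b
      adjacent : u ~ w
  open Edge

  edge? : ∀ a b u w → Dec (Edge a b u w)
  edge? a b u w = map′ (λ (cu , cw , u~w) → edge cu cw u~w) (λ (edge cu cw u~w) → cu , cw , u~w)
                       ((c u Fin.≟ a) ×-dec ((c w Fin.≟ b) ×-dec (u ~? w)))

  Edge-flip : ∀ {a b u w} → Edge a b u w → Edge b a w u
  Edge-flip {u = u} {w} (edge cu cw u~w) = edge cw cu (~-sym u w u~w)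

  same-colour⇒≁ : ∀ {u v} → c u ≡ c v → ¬ u ~ v
  same-colour⇒≁ {u} {v} cu≡cv u~v = proj₁ avoiding u v u~v cu≡cv

  cross-edge : ∀ {a b u₁ w₁ u₂ w₂} → Edge a b u₁ w₁ → Edge a b u₂ w₂ → u₁ ~ w₂ ⊎ u₂ ~ w₁
  cross-edge {a} {b} {u₁} {w₁} {u₂} {w₂} e₁ e₂ with u₁ ~? w₂ | u₂ ~? w₁
  ... | yes u₁~w₂ | _         = inj₁ u₁~w₂
  ... | no _      | yes u₂~w₁ = inj₂ u₂~w₁
  ... | no u₁≁w₂  | no u₂≁w₁  =
    ⊥-elim (proj₂ avoiding a b a≢b (Induced2K₂⇒copy (Q d) ~-sym ~-irrefl induced c a b coloured))
    where
    a≢b : a ≢ b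
    a≢b a≡b = same-colour⇒≁ (trans (colour-u e₁) (trans a≡b (sym (colour-w e₁)))) (adjacent e₁)
    induced : Induced2K₂ (Q d) u₁ w₁ u₂ w₂
    induced = record
      { p~q = adjacent e₁
      ; r~s = adjacent e₂
      ; p≁r = same-colour⇒≁ (trans (colour-u e₁) (sym (colour-u e₂)))
      ; p≁s = u₁≁w₂
      ; q≁r = λ w₁~u₂ → u₂≁w₁ (~-sym w₁ u₂ w₁~u₂)
      ; q≁s = same-colour⇒≁ (trans (colour-w e₁) (sym (colour-w e₂)))
      }
    coloured : ∀ x → c (quadruple u₁ w₁ u₂ w₂ x) ≡ a ⊎ c (quadruple u₁ w₁ u₂ w₂ x) ≡ b
    coloured zero                   = inj₁ (colour-u e₁)
    coloured (suc zero)             = inj₂ (colour-w e₁)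
    coloured (suc (suc zero))       = inj₁ (colour-u e₂)
    coloured (suc (suc (suc zero))) = inj₂ (colour-w e₂)

  deg : Fin k → Fin k → Vertex d → ℕ
  deg a b u = count (edge? a b u)

  edges : Fin k → Fin k → ℕ
  edges a b = count₂ (edge? a b)

  edges-from : ∀ {a b u} → (λ w → Edge a b u w) ⊆ (λ w → w ~ u)
  edges-from {u = u} {w} e = ~-sym u w (adjacent e)

  deg≤d : ∀ a b u → deg a b u ≤ d
  deg≤d a b u = subst (deg a b u ≤_) (degree u) (count-mono (edge? a b u) (λ w → w ~? u) edges-from)

  full-degree⇒neighbours-coloured : ∀ {a b u} → d ≤ deg a b u → ∀ {w} → w ~ u → c w ≡ b
  full-degree⇒neighbours-coloured {a} {b} {u} full {w} w~u with c w Fin.≟ b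
  ... | yes cw≡b = cw≡b
  ... | no  cw≢b = contradiction full (<⇒≱ (subst (deg a b u <_) (degree u)
          (count-< (edge? a b u) (λ v → v ~? u) edges-from w~u (λ e → cw≢b (colour-w e)))))

  Dominates : Fin k → Fin k → Vertex d → Set
  Dominates a b x = ∀ {u w} → Edge a b u w → w ~ x

  max-degree-dominates : ∀ {a b x} → (∀ {u} → c u ≡ a → deg a b u ≤ deg a b x) → Dominates a b x
  max-degree-dominates {a} {b} {x} max {u} {w} e with w ~? x
  ... | yes w~x = w~x
  ... | no  w≁x = contradiction (max (colour-u e)) (<⇒≱ (count-< (edge? a b x) (edge? a b u)
                    x-edges⊆u-edges e (λ e′ → w≁x (~-sym x w (adjacent e′)))))
    where
    x-edges⊆u-edges : ∀ {w′} → Edge a b x w′ → Edge a b u w′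
    x-edges⊆u-edges {w′} e′ with cross-edge e′ e
    ... | inj₁ x~w  = contradiction (~-sym x w x~w) w≁x
    ... | inj₂ u~w′ = edge (colour-u e) (colour-w e′) u~w′

  module TwoClasses {a b x y} (xy : Edge a b x y)
                    (x-dominates : Dominates a b x) (y-dominates : Dominates b a y) where

    record OffEdge (u w : Vertex d) : Set where
      constructor off-edge
      field
        is-edge : Edge a b u w
        u≢x     : u ≢ x
        w≢y     : w ≢ y
    open OffEdge

    off-edge? : ∀ u w → Dec (OffEdge u w)
    off-edge? u w = map′ (λ (e , u≢x , w≢y) → off-edge e u≢x w≢y) (λ (off-edge e u≢x w≢y) → e , u≢x , w≢y)
                         (edge? a b u w ×-dec (¬? (u ≟ᵛ x) ×-dec ¬? (w ≟ᵛ y)))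

    -- Every off-edge u w closes a 4-cycle x y u w, so two off-edges sharing a vertex would give a K₂,₃.
    private
      x~y : x ~ y
      x~y = adjacent xy

      u~y : ∀ {u w} → OffEdge u w → u ~ y
      u~y o = y-dominates (Edge-flip (is-edge o))

      w~x : ∀ {u w} → OffEdge u w → w ~ x
      w~x o = x-dominates (is-edge o)

      same-tail : ∀ {u w₁ w₂} → OffEdge u w₁ → w₂ ≢ y → w₂ ~ x → u ~ w₂ → w₁ ≡ w₂
      same-tail {u} {w₁} {w₂} o w₂≢y w₂~x u~w₂ with w₁ ≟ᵛ w₂
      ... | yes w₁≡w₂ = w₁≡w₂
      ... | no  w₁≢w₂ = ⊥-elim (K₂,₃-free x u y w₁ w₂ (λ x≡u → u≢x o (sym x≡u))
                          (λ y≡w₁ → w≢y o (sym y≡w₁)) (λ y≡w₂ → w₂≢y (sym y≡w₂)) w₁≢w₂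
                          (~-sym x y x~y) (~-sym u y (u~y o)) (w~x o) (~-sym u w₁ (adjacent (is-edge o)))
                          w₂~x (~-sym u w₂ u~w₂))

      same-head : ∀ {u₁ u₂ w} → OffEdge u₁ w → u₂ ≢ x → u₂ ~ y → u₂ ~ w → u₁ ≡ u₂
      same-head {u₁} {u₂} {w} o u₂≢x u₂~y u₂~w with u₁ ≟ᵛ u₂
      ... | yes u₁≡u₂ = u₁≡u₂
      ... | no  u₁≢u₂ = ⊥-elim (K₂,₃-free y w x u₁ u₂ (λ y≡w → w≢y o (sym y≡w))
                          (λ x≡u₁ → u≢x o (sym x≡u₁)) (λ x≡u₂ → u₂≢x (sym x≡u₂)) u₁≢u₂
                          x~y (~-sym w x (w~x o)) (u~y o) (adjacent (is-edge o))
                          u₂~y u₂~w)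

      unique-if-crossing : ∀ {u₁ w₁ u₂ w₂} → OffEdge u₁ w₁ → OffEdge u₂ w₂ → u₁ ~ w₂ →
                           u₁ ≡ u₂ × w₁ ≡ w₂
      unique-if-crossing o₁ o₂ u₁~w₂ =
        sym (same-head o₂ (u≢x o₁) (u~y o₁) u₁~w₂) , same-tail o₁ (w≢y o₂) (w~x o₂) u₁~w₂

    off-edge-unique : ∀ {u₁ w₁ u₂ w₂} → OffEdge u₁ w₁ → OffEdge u₂ w₂ → u₁ ≡ u₂ × w₁ ≡ w₂
    off-edge-unique o₁ o₂ with cross-edge (is-edge o₁) (is-edge o₂)
    ... | inj₁ u₁~w₂ = unique-if-crossing o₁ o₂ u₁~w₂
    ... | inj₂ u₂~w₁ with unique-if-crossing o₂ o₁ u₂~w₁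
    ...   | u₂≡u₁ , w₂≡w₁ = sym u₂≡u₁ , sym w₂≡w₁

    no-off-edge-if-full : 3 ≤ d → d ≤ deg a b x → d ≤ deg b a y → ∀ {u₁ w₁} → ¬ OffEdge u₁ w₁
    no-off-edge-if-full 3≤d x-full y-full {u₁} o₁ with third-neighbour 3≤d y x u₁
    ... | u , u~y , u≢x , u≢u₁ with complete-square x y u x~y (~-sym u y u~y) (λ x≡u → u≢x (sym x≡u))
    ...   | z , z~x , z~u , z≢y = u≢u₁ (sym (proj₁ (off-edge-unique o₁ o)))
      where
      o : OffEdge u z
      o = off-edge (edge (full-degree⇒neighbours-coloured y-full u~y)
                         (full-degree⇒neighbours-coloured x-full z~x)
                         (~-sym z u z~u))
                   u≢x z≢y

    off-edges : ℕ
    off-edges = count₂ off-edge?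

    edges+1≤ : edges a b + 1 ≤ deg a b x + (deg b a y + off-edges)
    edges+1≤ = begin
      edges a b + 1
        ≡⟨ cong (edges a b +_) (trans (∑Q²-δˡ d x _) (∑Q-δ d y)) ⟨
      edges a b + ∑Q² d (λ u w → δx u * δy w)
        ≡⟨ ∑Q²-+ d _ _ ⟨
      ∑Q² d (λ u w → E u w + δx u * δy w)
        ≤⟨ ∑Q²-mono d pointwise ⟩
      ∑Q² d (λ u w → δx u * E x w + (δy w * E′ y u + O u w))
        ≡⟨ trans (∑Q²-+ d (λ u w → δx u * E x w) _)
                 (cong (∑Q² d (λ u w → δx u * E x w) +_) (∑Q²-+ d (λ u w → δy w * E′ y u) O)) ⟩
      ∑Q² d (λ u w → δx u * E x w) + (∑Q² d (λ u w → δy w * E′ y u) + off-edges)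
        ≡⟨ cong₂ (λ m n → m + (n + off-edges)) (∑Q²-δˡ d x _) (∑Q²-δʳ d y _) ⟩
      deg a b x + (deg b a y + off-edges)
        ∎
      where
      open ≤-Reasoning
      δx δy : Vertex d → ℕ
      δx u = 𝟙 (u ≟ᵛ x)
      δy w = 𝟙 (w ≟ᵛ y)
      E E′ O : Vertex d → Vertex d → ℕ
      E u w  = 𝟙 (edge? a b u w)
      E′ w u = 𝟙 (edge? b a w u)
      O u w  = 𝟙 (off-edge? u w)
      -- The edge x y is counted both in the star of x and in the star of y.
      pointwise : ∀ u w → E u w + δx u * δy w ≤ δx u * E x w + (δy w * E′ y u + O u w)
      pointwise u w = by-cases (u ≟ᵛ x) (w ≟ᵛ y)
        where
        by-cases : (u≟x : Dec (u ≡ x)) (w≟y : Dec (w ≡ y)) →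
                   E u w + 𝟙 u≟x * 𝟙 w≟y ≤ 𝟙 u≟x * E x w + (𝟙 w≟y * E′ y u + O u w)
        by-cases (yes refl) (yes refl)
          rewrite 𝟙-yes (edge? a b u w) xy | 𝟙-yes (edge? b a w u) (Edge-flip xy) = s≤s (s≤s z≤n)
        by-cases (yes refl) (no _) = ≤-trans (≤-reflexive (+-identityʳ (E u w)))
                                             (≤-trans (m≤m+n (E u w) 0) (m≤m+n _ _))
        by-cases (no _) (yes refl) = ≤-trans (≤-reflexive (+-identityʳ (E u w)))
                                             (≤-trans (𝟙-mono (edge? a b u w) (edge? b a w u) Edge-flip)
                                                      (≤-trans (m≤m+n _ 0) (m≤m+n _ _)))
        by-cases (no u≢x) (no w≢y) = ≤-trans (≤-reflexive (+-identityʳ (E u w)))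
                                             (𝟙-mono (edge? a b u w) (off-edge? u w) (λ e → off-edge e u≢x w≢y))

    off-edges≤deficit : 3 ≤ d → off-edges ≤ (d ∸ deg a b x) + (d ∸ deg b a y)
    off-edges≤deficit 3≤d with d ≤? deg a b x | d ≤? deg b a y
    ... | yes x-full | yes y-full =
      ≤-trans (≮⇒≥ λ 0<off → let (_ , _ , o) = count₂-∃ off-edge? 0<off
                              in no-off-edge-if-full 3≤d x-full y-full o)
              z≤n
    ... | no x-deficient | _ =
      ≤-trans (count₂-≤1 off-edge? off-edge-unique) (≤-trans (m<n⇒0<n∸m (≰⇒> x-deficient)) (m≤m+n _ _))
    ... | yes _ | no y-deficient =
      ≤-trans (count₂-≤1 off-edge? off-edge-unique) (≤-trans (m<n⇒0<n∸m (≰⇒> y-deficient)) (m≤n+m _ _))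

    edges≤2d∸1 : 3 ≤ d → edges a b ≤ 2 * d ∸ 1
    edges≤2d∸1 3≤d = m+n≤o⇒m≤o∸n (edges a b) (begin
      edges a b + 1                          ≤⟨ edges+1≤ ⟩
      D + (D′ + off-edges)                   ≤⟨ +-monoʳ-≤ D (+-monoʳ-≤ D′ (off-edges≤deficit 3≤d)) ⟩
      D + (D′ + ((d ∸ D) + (d ∸ D′)))        ≡⟨ sym (+-assoc D D′ _) ⟩
      (D + D′) + ((d ∸ D) + (d ∸ D′))        ≡⟨ +-interchange D D′ _ _ ⟩
      (D + (d ∸ D)) + (D′ + (d ∸ D′))        ≡⟨ cong₂ _+_ (m+[n∸m]≡n (deg≤d a b x)) (m+[n∸m]≡n (deg≤d b a y)) ⟩
      d + d                                  ≡⟨ cong (d +_) (+-identityʳ d) ⟨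
      2 * d                                  ∎)
      where
      open ≤-Reasoning
      D D′ : ℕ
      D  = deg a b x
      D′ = deg b a y

  edges≤2d∸1 : 3 ≤ d → ∀ a b → edges a b ≤ 2 * d ∸ 1
  edges≤2d∸1 3≤d a b with edges a b ≟ 0
  ... | yes no-edges = subst (_≤ 2 * d ∸ 1) (sym no-edges) z≤n
  ... | no  some-edge with count₂-∃ (edge? a b) (n≢0⇒n>0 some-edge)
  ...   | _ , w₀ , e₀ with argmax-on (λ u → c u Fin.≟ a) (deg a b) (colour-u e₀)
                        | argmax-on (λ w → c w Fin.≟ b) (deg b a) (colour-w e₀)
  ...     | x , cx , x-max | y , cy , y-max =
    TwoClasses.edges≤2d∸1 xy x-dominates y-dominates 3≤d
    where
    x-dominates : Dominates a b x
    x-dominates = max-degree-dominates x-max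
    y-dominates : Dominates b a y
    y-dominates = max-degree-dominates y-max
    xy : Edge a b x y
    xy = edge cx cy (y-dominates (Edge-flip (edge cx (colour-w e₀) (~-sym w₀ x (x-dominates e₀)))))

  edges-monochromatic : ∀ a → edges a a ≡ 0
  edges-monochromatic a = n≤0⇒n≡0 (≮⇒≥ λ 0<edges →
    let (_ , _ , e) = count₂-∃ (edge? a a) 0<edges
    in same-colour⇒≁ (trans (colour-u e) (sym (colour-w e))) (adjacent e))

  adjacent-pairs-by-colours : count₂ (_~?_ {d}) ≡ ∑F k (λ a → ∑F k (λ b → edges a b))
  adjacent-pairs-by-colours = trans (∑Q-cong d (λ u → ∑Q-cong d (λ w → sym (split u w))))
                                    (∑Q²-∑F²-comm d k _)
    where
    split : ∀ u w → ∑F k (λ a → ∑F k (λ b → 𝟙 (edge? a b u w))) ≡ 𝟙 (u ~? w)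
    split u w = begin
      ∑F k (λ a → ∑F k (λ b → 𝟙 (edge? a b u w)))
        ≡⟨ ∑F-cong k (λ a → ∑F-cong k (λ b → trans (𝟙-× (c u Fin.≟ a) ((c w Fin.≟ b) ×-dec (u ~? w)))
                                 (cong (𝟙 (c u Fin.≟ a) *_) (𝟙-× (c w Fin.≟ b) (u ~? w))))) ⟩
      ∑F k (λ a → ∑F k (λ b → 𝟙 (c u Fin.≟ a) * (𝟙 (c w Fin.≟ b) * 𝟙 (u ~? w))))
        ≡⟨ ∑F-cong k (λ a → ∑F-*ˡ k (𝟙 (c u Fin.≟ a)) _) ⟩
      ∑F k (λ a → 𝟙 (c u Fin.≟ a) * ∑F k (λ b → 𝟙 (c w Fin.≟ b) * 𝟙 (u ~? w)))
        ≡⟨ ∑F-δ* (c u) _ ⟩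
      ∑F k (λ b → 𝟙 (c w Fin.≟ b) * 𝟙 (u ~? w))
        ≡⟨ ∑F-δ* (c w) _ ⟩
      𝟙 (u ~? w)
        ∎
      where open ≡-Reasoning

  adjacent-pairs-bound : 3 ≤ d → 2 ^ d * d ≤ k * (k ∸ 1) * (2 * d ∸ 1)
  adjacent-pairs-bound 3≤d = begin
    2 ^ d * d                                                ≡⟨ adjacent-pairs d ⟨
    count₂ (_~?_ {d})                                        ≡⟨ adjacent-pairs-by-colours ⟩
    ∑F k (λ a → ∑F k (λ b → edges a b))                      ≤⟨ ∑F-mono k (λ a → ∑F-mono k (pointwise a)) ⟩
    ∑F k (λ a → ∑F k (λ b → M * 𝟙 (¬? (a Fin.≟ b))))        ≡⟨ ∑F-cong k (λ a → trans (∑F-*ˡ k M _) (cong (M *_) (∑F-≢ a))) ⟩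
    ∑F k (λ _ → M * (k ∸ 1))                                 ≡⟨ ∑F-const k _ ⟩
    k * (M * (k ∸ 1))                                        ≡⟨ cong (k *_) (*-comm M (k ∸ 1)) ⟩
    k * ((k ∸ 1) * M)                                        ≡⟨ *-assoc k (k ∸ 1) M ⟨
    k * (k ∸ 1) * M                                          ∎
    where
    open ≤-Reasoning
    M : ℕ
    M = 2 * d ∸ 1
    pointwise : ∀ a b → edges a b ≤ M * 𝟙 (¬? (a Fin.≟ b))
    pointwise a b with a Fin.≟ b
    ... | yes refl = ≤-reflexive (trans (edges-monochromatic a) (sym (*-zeroʳ M)))
    ... | no _     = subst (edges a b ≤_) (sym (*-identityʳ M)) (edges≤2d∸1 3≤d a b)

-- The cubes Q₂ and Q₃

all-vertices? : ∀ {d} {P : Pred (Vertex d) 0ℓ} → Decidable P → Dec (∀ v → P v)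
all-vertices? {zero}  P? = map′ (λ P[] → λ { [] → P[] }) (λ all → all []) (P? [])
all-vertices? {suc d} P? =
  map′ (λ (all₁ , all₀) → λ { (true ∷ v) → all₁ v ; (false ∷ v) → all₀ v })
       (λ all → (λ v → all (true ∷ v)) , (λ v → all (false ∷ v)))
       (all-vertices? (λ v → P? (true ∷ v)) ×-dec all-vertices? (λ v → P? (false ∷ v)))

some-vertex? : ∀ {d} {P : Pred (Vertex d) 0ℓ} → Decidable P → Dec (∃ P)
some-vertex? {zero}  P? = map′ ([] ,_) (λ { ([] , P[]) → P[] }) (P? [])
some-vertex? {suc d} P? =
  map′ (λ { (inj₁ (v , p)) → true ∷ v , p ; (inj₂ (v , p)) → false ∷ v , p })
       (λ { (true ∷ v , p) → inj₁ (v , p) ; (false ∷ v , p) → inj₂ (v , p) })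
       (some-vertex? (λ v → P? (true ∷ v)) ⊎-dec some-vertex? (λ v → P? (false ∷ v)))

glue : ∀ {d m} → (Vertex d → Fin m) → (Vertex d → Fin m) → Vertex (suc d) → Fin m
glue c₁ c₀ (true ∷ v)  = c₁ v
glue c₁ c₀ (false ∷ v) = c₀ v

all-colourings? : ∀ d m {P : (Vertex d → Fin m) → Set} →
  (∀ {c c′} → (∀ v → c v ≡ c′ v) → P c → P c′) → (∀ c → Dec (P c)) → Dec (∀ c → P c)
all-colourings? zero m resp P? =
  map′ (λ all c → resp (λ { [] → refl }) (all (c [])))
       (λ all i → all (λ _ → i))
       (Fin.all? (λ i → P? (λ _ → i)))
all-colourings? (suc d) m resp P? =
  map′ (λ all c → resp (λ { (true ∷ v) → refl ; (false ∷ v) → refl })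
                       (all (λ v → c (true ∷ v)) (λ v → c (false ∷ v))))
       (λ all c₁ c₀ → all (glue c₁ c₀))
       (all-colourings? d m (λ c₁≗ all c₀ → resp (glue-cong c₁≗ (λ _ → refl)) (all c₀))
          (λ c₁ → all-colourings? d m (λ c₀≗ → resp (glue-cong (λ _ → refl) c₀≗)) (λ c₀ → P? (glue c₁ c₀))))
  where
  glue-cong : ∀ {c₁ c₁′ c₀ c₀′ : Vertex d → Fin m} → (∀ v → c₁ v ≡ c₁′ v) → (∀ v → c₀ v ≡ c₀′ v) →
              ∀ v → glue c₁ c₀ v ≡ glue c₁′ c₀′ v
  glue-cong c₁≗ c₀≗ (true ∷ v)  = c₁≗ v
  glue-cong c₁≗ c₀≗ (false ∷ v) = c₀≗ v

induced? : ∀ {d} (p q r s : Vertex d) → Dec (Induced2K₂ (Q d) p q r s)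
induced? p q r s =
  map′ (λ (p~q , r~s , p≁r , p≁s , q≁r , q≁s) → record
         { p~q = p~q ; r~s = r~s ; p≁r = p≁r ; p≁s = p≁s ; q≁r = q≁r ; q≁s = q≁s })
       (λ i → let open Induced2K₂ i in p~q , r~s , p≁r , p≁s , q≁r , q≁s)
       ((p ~? q) ×-dec (r ~? s) ×-dec ¬? (p ~? r) ×-dec ¬? (p ~? s) ×-dec ¬? (q ~? r) ×-dec ¬? (q ~? s))

two-coloured? : ∀ {d m} (c : Vertex d → Fin m) (p q r s : Vertex d) → Dec (TwoColoured (Q d) c p q r s)
two-coloured? c p q r s = ((c r Fin.≟ c p) ⊎-dec (c r Fin.≟ c q)) ×-dec ((c s Fin.≟ c p) ⊎-dec (c s Fin.≟ c q))

avoiding? : ∀ {d m} (c : Vertex d → Fin m) → Dec (IsAvoiding TwoK2 (Q d) c)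
avoiding? {d} c = map′ from to (proper? ×-dec no-two-coloured?)
  where
  open Equivalence (avoiding⇔ (Q d) ~-sym ~-irrefl c)
  proper? : Dec (IsProper (Q d) c)
  proper? = all-vertices? λ u → all-vertices? λ v → (u ~? v) →-dec ¬? (c u Fin.≟ c v)
  no-two-coloured? : Dec (NoTwoColoured2K₂ (Q d) c)
  no-two-coloured? = all-vertices? λ p → all-vertices? λ q → all-vertices? λ r → all-vertices? λ s →
                       induced? p q r s →-dec ¬? (two-coloured? c p q r s)

proper-colouring-needs-two : (G : Graph) {k : ℕ} (c : Coloring G k) → IsProper G c →
  ∀ u v → Adj G u v → 2 ≤ k
proper-colouring-needs-two G {zero} c _ u _ _ with c u
... | ()
proper-colouring-needs-two G {suc zero} c proper u v u~v with c u | c v | proper u v u~v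
... | zero | zero | cu≢cv = contradiction refl cu≢cv
proper-colouring-needs-two G {suc (suc k)} _ _ _ _ _ = s≤s (s≤s z≤n)

Q₂-colouring : Vertex 2 → Fin 2
Q₂-colouring (false ∷ false ∷ []) = zero
Q₂-colouring (true ∷ true ∷ [])   = zero
Q₂-colouring (false ∷ true ∷ [])  = suc zero
Q₂-colouring (true ∷ false ∷ [])  = suc zero

Q₃-colouring : Vertex 3 → Fin 4
Q₃-colouring (false ∷ false ∷ false ∷ []) = zero
Q₃-colouring (true ∷ false ∷ true ∷ [])   = zero
Q₃-colouring (false ∷ false ∷ true ∷ [])  = suc zero
Q₃-colouring (false ∷ true ∷ false ∷ [])  = suc zero
Q₃-colouring (false ∷ true ∷ true ∷ [])   = suc (suc zero)
Q₃-colouring (true ∷ true ∷ false ∷ [])   = suc (suc zero)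
Q₃-colouring (true ∷ false ∷ false ∷ [])  = suc (suc (suc zero))
Q₃-colouring (true ∷ true ∷ true ∷ [])    = suc (suc (suc zero))

χ[Q₂]≡2 : ChiIs TwoK2 (Q 2) 2
χ[Q₂]≡2 = (Q₂-colouring , from-yes (avoiding? Q₂-colouring)) ,
          λ m (c , proper , _) → proper-colouring-needs-two (Q 2) c proper (false ∷ false ∷ []) (true ∷ false ∷ []) refl

antipode : ∀ {d} → Vertex d → Vertex d
antipode = Vec.map not

-- In Q₃ an edge and its antipodal edge induce a 2K₂; every colouring with fewer than four colours
-- has such a pair using only two colours, or a monochromatic edge (checked exhaustively below).
Obstruction : ∀ {m} → (Vertex 3 → Fin m) → Set
Obstruction c = ∃₂ λ u v → (u ~ v × c u ≡ c v)
                      ⊎ (Induced2K₂ (Q 3) u v (antipode u) (antipode v) × TwoColoured (Q 3) c u v (antipode u) (antipode v))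

obstruction? : ∀ {m} (c : Vertex 3 → Fin m) → Dec (Obstruction c)
obstruction? c = some-vertex? λ u → some-vertex? λ v →
  ((u ~? v) ×-dec (c u Fin.≟ c v))
  ⊎-dec (induced? u v (antipode u) (antipode v) ×-dec two-coloured? c u v (antipode u) (antipode v))

Obstruction-resp : ∀ {m} {c c′ : Vertex 3 → Fin m} → (∀ v → c v ≡ c′ v) → Obstruction c → Obstruction c′
Obstruction-resp {c = c} {c′} c≗c′ (u , v , refutation) = u , v , Sum.map (Product.map₂ recolour) (Product.map₂ two-coloured-resp) refutation
  where
  recolour : ∀ {x y} → c x ≡ c y → c′ x ≡ c′ y
  recolour {x} {y} cx≡cy = trans (sym (c≗c′ x)) (trans cx≡cy (c≗c′ y))
  two-coloured-resp : ∀ {p q r s} → TwoColoured (Q 3) c p q r s → TwoColoured (Q 3) c′ p q r s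
  two-coloured-resp = Product.map (Sum.map recolour recolour) (Sum.map recolour recolour)

obstruction⇒¬avoiding : ∀ {m} (c : Vertex 3 → Fin m) → Obstruction c → ¬ IsAvoiding TwoK2 (Q 3) c
obstruction⇒¬avoiding c (u , v , inj₁ (u~v , same)) (proper , _) = proper u v u~v same
obstruction⇒¬avoiding c (u , v , inj₂ (induced , two-coloured)) avoiding =
  proj₂ (Equivalence.to (avoiding⇔ (Q 3) ~-sym ~-irrefl c) avoiding) _ _ _ _ induced two-coloured

χ[Q₃]≡4 : ChiIs TwoK2 (Q 3) 4
χ[Q₃]≡4 = (Q₃-colouring , from-yes (avoiding? Q₃-colouring)) , lower
  where
  lower : ∀ m → HasAvoidingColoring TwoK2 (Q 3) m → 4 ≤ m
  lower m (c , avoiding)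
    with proper-colouring-needs-two (Q 3) c (proj₁ avoiding) (false ∷ false ∷ false ∷ []) (true ∷ false ∷ false ∷ []) refl
  lower 1 _ | s≤s ()
  lower 2 (c , avoiding) | _ =
    contradiction avoiding (obstruction⇒¬avoiding c (from-yes (all-colourings? 3 2 Obstruction-resp obstruction?) c))
  lower 3 (c , avoiding) | _ =
    contradiction avoiding (obstruction⇒¬avoiding c (from-yes (all-colourings? 3 3 Obstruction-resp obstruction?) c))
  lower (suc (suc (suc (suc m)))) _ | _ = s≤s (s≤s (s≤s (s≤s z≤n)))

4k[k∸1]≤[2k∸1]² : ∀ k → 4 * (k * (k ∸ 1)) ≤ (2 * k ∸ 1) * (2 * k ∸ 1)
4k[k∸1]≤[2k∸1]² zero    = z≤n
4k[k∸1]≤[2k∸1]² (suc m) = subst (4 * (suc m * m) ≤_) (square m) (m≤m+n _ 1)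
  where
  square : ∀ m → 4 * (suc m * m) + 1 ≡ (m + suc (m + 0)) * (m + suc (m + 0))
  square = solve-∀

corollary5p5 :
    ChiIs TwoK2 (Q 2) 2
      × ChiIs TwoK2 (Q 3) 4
      × (∀ d → 4 ≤ d → ∀ k → HasAvoidingColoring TwoK2 (Q d) k →
           4 * d * 2 ^ d ≤ (2 * k ∸ 1) * (2 * k ∸ 1) * (2 * d ∸ 1))
corollary5p5 = χ[Q₂]≡2 , χ[Q₃]≡4 , lower-bound
  where
  lower-bound : ∀ d → 4 ≤ d → ∀ k → HasAvoidingColoring TwoK2 (Q d) k →
                4 * d * 2 ^ d ≤ (2 * k ∸ 1) * (2 * k ∸ 1) * (2 * d ∸ 1)
  lower-bound d 4≤d k (c , avoiding) = begin
    4 * d * 2 ^ d                     ≡⟨ trans (*-assoc 4 d (2 ^ d)) (cong (4 *_) (*-comm d (2 ^ d))) ⟩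
    4 * (2 ^ d * d)                   ≤⟨ *-monoʳ-≤ 4 (Avoiding.adjacent-pairs-bound c avoiding (<⇒≤ 4≤d)) ⟩
    4 * (k * (k ∸ 1) * M)             ≡⟨ *-assoc 4 (k * (k ∸ 1)) M ⟨
    4 * (k * (k ∸ 1)) * M             ≤⟨ *-monoˡ-≤ M (4k[k∸1]≤[2k∸1]² k) ⟩
    (2 * k ∸ 1) * (2 * k ∸ 1) * M     ∎
    where
    open ≤-Reasoning
    M : ℕ
    M = 2 * d ∸ 1
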